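{- For every $n\geq 0$, the colorful exchange graph $\mathcal{G}^{c}_n$ of a convex $(n+3)$-gon $N$ (with $n$-element color set $C(N)$) is connected.
   Context: Let $N$ be a convex $(n+3)$-gon with vertices $1,\ldots,n+3$ in cyclic order, and $C(N)$ a set of $n$ colors. A colored triangulation of $N$ is a triangulation of $N$ (by triangles with vertices among those of $N$; it has $n$ diagonals) whose diagonals are assigned pairwise distinct colors from $C(N)$. Flipping a diagonal $d$ of a colored triangulation means replacing $d$ by the other diagonal of the convex quadrilateral formed by the two triangles containing $d$, the new diagonal receiving the color of $d$. The graph $\mathcal{G}^{c}_n$ has vertex set the colored triangulations of $N$, with two vertices adjacent iff one arises from the other by a single flip. -}

module Defs where

open import Data.Nat using (ℕ; zero; suc; _+_; _<_)
open import Data.Fin using (Fin)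
open import Data.Product using (_×_; _,_; Σ; ∃-syntax)
open import Data.Sum using (_⊎_)
open import Data.Vec using (Vec; lookup; _[_]≔_)
open import Relation.Binary.PropositionalEquality using (_≡_; _≢_)
open import Relation.Nullary using (¬_)

-- Vertices of the convex (n+3)-gon are labelled 0,1,…,n+2 (in cyclic order)
-- (the paper's vertex i is our i-1).  A segment between two vertices is
-- stored as an ordered pair (a , b) with a < b.
Seg : Set
Seg = ℕ × ℕ

IsSeg : ℕ → Seg → Set
IsSeg n (a , b) = a < b × b < n + 3

IsEdge : ℕ → Seg → Set
IsEdge n (a , b) = IsSeg n (a , b) × (b ≡ suc a ⊎ (a ≡ 0 × b ≡ n + 2))

IsDiag : ℕ → Seg → Set
IsDiag n (a , b) = IsSeg n (a , b) × suc a < b × ¬ (a ≡ 0 × b ≡ n + 2)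

Cross : Seg → Seg → Set
Cross (a , b) (c , d) = (a < c × c < b × b < d) ⊎ (c < a × a < d × d < b)

-- A colored triangulation: the color set C(N) is Fin n, and v assigns to
-- each color k the diagonal  lookup v k  of color k.  The diagonals are
-- pairwise distinct (colors pairwise distinct and each diagonal colored)
-- and pairwise non-crossing; n pairwise non-crossing distinct diagonals of
-- a convex (n+3)-gon form exactly a triangulation.
ColTri : ℕ → Set
ColTri n = Vec Seg n

IsColTri : (n : ℕ) → ColTri n → Set
IsColTri n v =
  ((k : Fin n) → IsDiag n (lookup v k)) ×
  ((k l : Fin n) → k ≢ l → lookup v k ≢ lookup v l) ×
  ((k l : Fin n) → ¬ Cross (lookup v k) (lookup v l))

InTri : (n : ℕ) → ColTri n → Seg → Set
InTri n v s = IsEdge n s ⊎ ∃[ l ] (lookup v l ≡ s)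

-- Flip of the diagonal of color k:  lookup v k = (a , b);  the two
-- triangles of the triangulation containing it are {a,x,b} with a<x<b and
-- {a,b,y} with y outside [a,b]; the new diagonal (other diagonal of the
-- quadrilateral a,x,b,y) is {x,y} and keeps color k.
FlipAt : (n : ℕ) → ColTri n → Fin n → ColTri n → Set
FlipAt n v k w =
  Σ ℕ λ a → Σ ℕ λ b → Σ ℕ λ x → Σ ℕ λ y →
    lookup v k ≡ (a , b) × a < x × x < b ×
    InTri n v (a , x) × InTri n v (x , b) ×
    ( (y < a × InTri n v (y , a) × InTri n v (y , b) × w ≡ v [ k ]≔ (y , x))
    ⊎ (b < y × y < n + 3 × InTri n v (a , y) × InTri n v (b , y) × w ≡ v [ k ]≔ (x , y)))

Flip : (n : ℕ) → ColTri n → ColTri n → Set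
Flip n v w = IsColTri n v × ∃[ k ] FlipAt n v k w

Adj : (n : ℕ) → ColTri n → ColTri n → Set
Adj n v w = Flip n v w ⊎ Flip n w v

data Reachable (n : ℕ) : ColTri n → ColTri n → Set where
  here  : ∀ {v} → Reachable n v v
  there : ∀ {u v w} → Adj n u v → Reachable n v w → Reachable n u w

Connected : ℕ → Set
Connected n = (v w : ColTri n) → IsColTri n v → IsColTri n w → Reachable n v w

{-# OPTIONS --safe #-}
-- Every coloured triangulation is joined by flips to the fan at vertex 0 in which colour i sits on
-- (0 , n + 1 - i); connectivity follows by symmetry. By induction on n: flipping the diagonals at the
-- last vertex in order of increasing other end turns each of them into a diagonal at vertex 0, until
-- the ear cutting off the last vertex is a diagonal. Removing it leaves a coloured triangulation of the
-- smaller polygon, which reaches the fan by induction, and going around the 5-cycle of flips of a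
-- pentagon then moves the colour of the ear to 0.
-- Finding the two triangles on the sides of a diagonal rests on maximality: pairwise non-crossing
-- diagonals of an (n + 3)-gon number at most n (each has a point covered by no smaller one), so every
-- diagonal of the polygon belongs to the triangulation or crosses one of its diagonals.
module Submission where

open import Data.Nat
  using (ℕ; zero; suc; _+_; _<_; _≤_; _>_; _<?_; _≤?_; _≟_; _<ᵇ_; z≤n; s≤s; s≤s⁻¹; z<s; s<s; >-nonZero)
open import Data.Nat.Properties
open import Data.Fin as Fin using (Fin; toℕ; fromℕ<; punchIn; punchOut)
open import Data.Fin.Properties
  using (all?; any?; toℕ-fromℕ<; fromℕ<-injective; injective⇒≤; punchIn-punchOut; punchInᵢ≢i; punchIn-injective)
open import Data.Fin.Subset using (Subset; _∈_; _⊆_; _⊂_; ∣_∣)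
open import Data.Fin.Subset.Properties using (p⊆q⇒∣p∣≤∣q∣; p⊂q⇒∣p∣<∣q∣; ∣⊤∣≡n; ∈⊤)
open import Data.Vec using (Vec; []; _∷_; lookup; tabulate; _[_]≔_; insertAt; removeAt)
open import Data.Vec.Functional using () renaming (_∷_ to _∷ᶠ_)
open import Data.Vec.Properties
  using ( lookup∘tabulate; []=⇒lookup; lookup⇒[]=; lookup∘update; lookup∘update′
        ; insertAt-lookup; insertAt-punchIn; insertAt-removeAt)
open import Data.Bool.Properties using (T-≡)
open import Data.Product.Properties using (,-injectiveˡ; ,-injectiveʳ; ≡-dec)
open import Data.Product using (_×_; _,_; proj₁; proj₂; uncurry; ∃)
open import Data.Sum using (_⊎_; inj₁; inj₂)
open import Function using (_∘_; id; case_of_; _⇔_; mk⇔; Equivalence)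
open import Relation.Binary.PropositionalEquality
open import Relation.Nullary using (¬_; Dec; yes; no; map′; contradiction)
open import Relation.Binary.Definitions using (DecidableEquality)
open import Relation.Unary using (Decidable)
open import Relation.Nullary.Decidable using (_×-dec_; _⊎-dec_; _→-dec_; ¬?; True; toWitness; decidable-stable)

open import Defs

-- Quantifier-free order formulas over ℕ

infixr 4 _:⇒_
infixr 5 _:∨_
infixr 6 _:∧_
infix 8 _:<_ _:≤_ _:≡_

data Formula (k : ℕ) : Set where
  _:<_ _:≤_ _:≡_ : Fin k → Fin k → Formula k
  _:∧_ _:∨_ _:⇒_ : Formula k → Formula k → Formula k
  :¬_ : Formula k → Formula k

⟦_⟧ : ∀ {k} → Formula k → (Fin k → ℕ) → Set
⟦ i :< j ⟧ ρ = ρ i < ρ j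
⟦ i :≤ j ⟧ ρ = ρ i ≤ ρ j
⟦ i :≡ j ⟧ ρ = ρ i ≡ ρ j
⟦ φ :∧ ψ ⟧ ρ = ⟦ φ ⟧ ρ × ⟦ ψ ⟧ ρ
⟦ φ :∨ ψ ⟧ ρ = ⟦ φ ⟧ ρ ⊎ ⟦ ψ ⟧ ρ
⟦ φ :⇒ ψ ⟧ ρ = ⟦ φ ⟧ ρ → ⟦ ψ ⟧ ρ
⟦ :¬ φ ⟧ ρ = ¬ ⟦ φ ⟧ ρ

⟦⟧? : ∀ {k} (φ : Formula k) ρ → Dec (⟦ φ ⟧ ρ)
⟦⟧? (i :< j) ρ = ρ i <? ρ j
⟦⟧? (i :≤ j) ρ = ρ i ≤? ρ j
⟦⟧? (i :≡ j) ρ = ρ i ≟ ρ j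
⟦⟧? (φ :∧ ψ) ρ = ⟦⟧? φ ρ ×-dec ⟦⟧? ψ ρ
⟦⟧? (φ :∨ ψ) ρ = ⟦⟧? φ ρ ⊎-dec ⟦⟧? ψ ρ
⟦⟧? (φ :⇒ ψ) ρ = ⟦⟧? φ ρ →-dec ⟦⟧? ψ ρ
⟦⟧? (:¬ φ) ρ = ¬? (⟦⟧? φ ρ)

module _ {k : ℕ} where

  OrderEquivalent : (ρ σ : Fin k → ℕ) → Set
  OrderEquivalent ρ σ = ∀ i j → ρ i < ρ j ⇔ σ i < σ j

  OrderEquivalent-sym : ∀ {ρ σ} → OrderEquivalent ρ σ → OrderEquivalent σ ρ
  OrderEquivalent-sym e i j = mk⇔ (Equivalence.from (e i j)) (Equivalence.to (e i j))

  transfer : ∀ {ρ σ} → OrderEquivalent ρ σ → (φ : Formula k) → ⟦ φ ⟧ ρ → ⟦ φ ⟧ σ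
  transfer e (i :< j) p = Equivalence.to (e i j) p
  transfer e (i :≤ j) p = ≮⇒≥ (λ q → <⇒≱ (Equivalence.from (e j i) q) p)
  transfer e (i :≡ j) p =
    ≤-antisym (transfer e (i :≤ j) (≤-reflexive p)) (transfer e (j :≤ i) (≤-reflexive (sym p)))
  transfer e (φ :∧ ψ) (p , q) = transfer e φ p , transfer e ψ q
  transfer e (φ :∨ ψ) (inj₁ p) = inj₁ (transfer e φ p)
  transfer e (φ :∨ ψ) (inj₂ q) = inj₂ (transfer e ψ q)
  transfer e (φ :⇒ ψ) f = transfer e ψ ∘ f ∘ transfer (OrderEquivalent-sym e) φ
  transfer e (:¬ φ) f = f ∘ transfer (OrderEquivalent-sym e) φ


module _ {k : ℕ} (ρ : Fin k → ℕ) where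

  below : Fin k → Subset k
  below i = tabulate λ j → ρ j <ᵇ ρ i

  ∈-below⁺ : ∀ {i j} → ρ j < ρ i → j ∈ below i
  ∈-below⁺ {i} {j} p =
    lookup⇒[]= j _ (trans (lookup∘tabulate (λ j → ρ j <ᵇ ρ i) j) (Equivalence.to T-≡ (<⇒<ᵇ p)))

  ∈-below⁻ : ∀ {i j} → j ∈ below i → ρ j < ρ i
  ∈-below⁻ {i} {j} p =
    <ᵇ⇒< _ _ (Equivalence.from T-≡ (trans (sym (lookup∘tabulate (λ j → ρ j <ᵇ ρ i) j)) ([]=⇒lookup p)))

  below-⊆ : ∀ {i j} → ρ i ≤ ρ j → below i ⊆ below j
  below-⊆ p x∈ = ∈-below⁺ (<-≤-trans (∈-below⁻ x∈) p)

  below-⊂ : ∀ {i j} → ρ i < ρ j → below i ⊂ below j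
  below-⊂ {i} p = below-⊆ (<⇒≤ p) , i , ∈-below⁺ p , λ i∈ → <-irrefl refl (∈-below⁻ i∈)

  rank : Fin k → ℕ
  rank i = ∣ below i ∣

  rank< : ∀ i → rank i < k
  rank< i = subst (rank i <_) (∣⊤∣≡n k)
    (p⊂q⇒∣p∣<∣q∣ ((λ _ → ∈⊤) , i , ∈⊤ , λ i∈ → <-irrefl refl (∈-below⁻ i∈)))

  rank-OrderEquivalent : OrderEquivalent ρ rank
  rank-OrderEquivalent i j = mk⇔ (p⊂q⇒∣p∣<∣q∣ ∘ below-⊂) λ r →
    decidable-stable (ρ i <? ρ j) λ q → <⇒≱ r (p⊆q⇒∣p∣≤∣q∣ (below-⊆ (≮⇒≥ q)))

∀-Vec? : ∀ {b k} {P : Vec (Fin b) k → Set} → (∀ xs → Dec (P xs)) → Dec (∀ xs → P xs)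
∀-Vec? {k = zero} P? = map′ (λ p → λ { [] → p }) (λ f → f []) (P? [])
∀-Vec? {k = suc k} P? =
  map′ (λ f → λ { (x ∷ xs) → f x xs }) (λ f x xs → f (x ∷ xs)) (all? λ x → ∀-Vec? λ xs → P? (x ∷ xs))

Valid : ∀ {k} → Formula k → Set
Valid {k} φ = True (∀-Vec? {k} {k} λ xs → ⟦⟧? φ (toℕ ∘ lookup xs))

-- A formula in k variables holds everywhere once it holds for all values below k: ranking the values
-- of any valuation gives an order-equivalent valuation of that kind.
valid : ∀ {k} (φ : Formula k) → Valid φ → ∀ ρ → ⟦ φ ⟧ ρ
valid {k} φ v ρ = transfer (OrderEquivalent-sym ρ≈xs) φ (toWitness v xs)
  where
  xs : Vec (Fin k) k
  xs = tabulate λ i → fromℕ< (rank< ρ i)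
  xs≡rank : ∀ i → toℕ (lookup xs i) ≡ rank ρ i
  xs≡rank i = trans (cong toℕ (lookup∘tabulate _ i)) (toℕ-fromℕ< (rank< ρ i))
  ρ≈xs : OrderEquivalent ρ (toℕ ∘ lookup xs)
  ρ≈xs i j = mk⇔ (subst₂ _<_ (sym (xs≡rank i)) (sym (xs≡rank j)) ∘ Equivalence.to (rank-OrderEquivalent ρ i j))
                 (Equivalence.from (rank-OrderEquivalent ρ i j) ∘ subst₂ _<_ (xs≡rank i) (xs≡rank j))

pattern #0 = Fin.zero
pattern #1 = Fin.suc #0
pattern #2 = Fin.suc #1
pattern #3 = Fin.suc #2
pattern #4 = Fin.suc #3
pattern #5 = Fin.suc #4

:Cross : ∀ {k} → Fin k → Fin k → Fin k → Fin k → Formula k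
:Cross a b c d = (a :< c :∧ c :< b :∧ b :< d) :∨ (c :< a :∧ a :< d :∧ d :< b)

Cross-sym : ∀ s t → Cross s t → Cross t s
Cross-sym _ _ (inj₁ c) = inj₂ c
Cross-sym _ _ (inj₂ c) = inj₁ c

Cross-irrefl : ∀ s → ¬ Cross s s
Cross-irrefl _ (inj₁ (a<a , _)) = <-irrefl refl a<a
Cross-irrefl _ (inj₂ (a<a , _)) = <-irrefl refl a<a

m<n+3⇒m≤n+2 : ∀ {m n} → m < n + 3 → m ≤ n + 2
m<n+3⇒m≤n+2 {m} {n} m<n+3 = s≤s⁻¹ (subst (m <_) (+-suc n 2) m<n+3)

Edge-noncrossing : ∀ {m s t} → IsSeg m s → IsEdge m t → ¬ Cross s t
Edge-noncrossing _ (_ , inj₁ refl) (inj₁ (_ , e<d , d<e+1)) = <⇒≱ e<d (s≤s⁻¹ d<e+1)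
Edge-noncrossing _ (_ , inj₁ refl) (inj₂ (e<c , c<e+1 , _)) = <⇒≱ e<c (s≤s⁻¹ c<e+1)
Edge-noncrossing _ (_ , inj₂ (refl , refl)) (inj₁ (() , _))
Edge-noncrossing (_ , d<m+3) (_ , inj₂ (refl , refl)) (inj₂ (_ , _ , m+2<d)) =
  <⇒≱ m+2<d (m<n+3⇒m≤n+2 d<m+3)

InTri-noncrossing : ∀ {m} v {s t} → IsSeg m s → (∀ l → ¬ Cross s (lookup v l)) → InTri m v t → ¬ Cross s t
InTri-noncrossing _ s-seg _ (inj₁ t-edge) = Edge-noncrossing s-seg t-edge
InTri-noncrossing _ _ uncrossed (inj₂ (l , refl)) = uncrossed l

InTri⇒IsSeg : ∀ {m} v {s} → IsColTri m v → InTri m v s → IsSeg m s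
InTri⇒IsSeg _ _ (inj₁ (seg , _)) = seg
InTri⇒IsSeg _ (diag , _) (inj₂ (l , refl)) = proj₁ (diag l)

diagonal-InTri-noncrossing : ∀ {m} v → IsColTri m v → ∀ l {t} → InTri m v t → ¬ Cross (lookup v l) t
diagonal-InTri-noncrossing v (diag , _ , noncrossing) l = InTri-noncrossing v (proj₁ (diag l)) (noncrossing l)

crossing-IsDiag : ∀ {m s t} → IsSeg m s → IsSeg m t → Cross s t → IsDiag m s
crossing-IsDiag s-seg (_ , f<m+3) (inj₁ (c<e , e<d , d<f)) =
  s-seg , <-≤-trans (s≤s c<e) e<d , λ { (_ , refl) → <⇒≱ d<f (m<n+3⇒m≤n+2 f<m+3) }
crossing-IsDiag s-seg _ (inj₂ (e<c , c<f , f<d)) = s-seg , <-≤-trans (s≤s c<f) f<d , λ { (refl , _) → n≮0 e<c }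

IsColTri-update : ∀ {m} v k {s} → IsColTri m v → IsDiag m s → Cross s (lookup v k) →
                  (∀ l → Cross (lookup v l) s → lookup v l ≡ lookup v k) → IsColTri m (v [ k ]≔ s)
IsColTri-update {m} v k {s} (diag , distinct , noncrossing) s-diag s⋈vk only-vk =
  diag′ , distinct′ , noncrossing′
  where
  w : ColTri m
  w = v [ k ]≔ s

  at-k : lookup w k ≡ s
  at-k = lookup∘update k v s

  off-k : ∀ {l} → l ≢ k → lookup w l ≡ lookup v l
  off-k l≢k = lookup∘update′ l≢k v s

  ¬crosses-s : ∀ {l} → l ≢ k → ¬ Cross (lookup v l) s
  ¬crosses-s l≢k vl⋈s = distinct _ _ l≢k (only-vk _ vl⋈s)

  ≢s : ∀ {l} → l ≢ k → lookup v l ≢ s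
  ≢s {l} _ refl = noncrossing l k s⋈vk

  diag′ : ∀ i → IsDiag m (lookup w i)
  diag′ i with i Fin.≟ k
  ... | yes refl rewrite at-k = s-diag
  ... | no i≢k rewrite off-k i≢k = diag i

  distinct′ : ∀ i j → i ≢ j → lookup w i ≢ lookup w j
  distinct′ i j i≢j with i Fin.≟ k | j Fin.≟ k
  ... | yes refl | yes refl = contradiction refl i≢j
  ... | yes refl | no j≢k rewrite at-k | off-k j≢k = ≢s j≢k ∘ sym
  ... | no i≢k | yes refl rewrite at-k | off-k i≢k = ≢s i≢k
  ... | no i≢k | no j≢k rewrite off-k i≢k | off-k j≢k = distinct i j i≢j

  noncrossing′ : ∀ i j → ¬ Cross (lookup w i) (lookup w j)
  noncrossing′ i j with i Fin.≟ k | j Fin.≟ k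
  ... | yes refl | yes refl rewrite at-k = Cross-irrefl s
  ... | yes refl | no j≢k rewrite at-k | off-k j≢k = ¬crosses-s j≢k ∘ Cross-sym s _
  ... | no i≢k | yes refl rewrite at-k | off-k i≢k = ¬crosses-s i≢k
  ... | no i≢k | no j≢k rewrite off-k i≢k | off-k j≢k = noncrossing i j

quadrilateral-chord : ∀ {q₀ q₁ q₂ q₃ c d} → q₀ < q₁ → q₁ < q₂ → q₂ < q₃ →
  ¬ Cross (c , d) (q₀ , q₁) → ¬ Cross (c , d) (q₁ , q₂) → ¬ Cross (c , d) (q₂ , q₃) → ¬ Cross (c , d) (q₀ , q₃) →
  (Cross (c , d) (q₁ , q₃) → c ≡ q₀ × d ≡ q₂) × (Cross (c , d) (q₀ , q₂) → c ≡ q₁ × d ≡ q₃)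
quadrilateral-chord {q₀} {q₁} {q₂} {q₃} {c} {d} = valid
  (#0 :< #1 :⇒ #1 :< #2 :⇒ #2 :< #3 :⇒
   :¬ :Cross #4 #5 #0 #1 :⇒ :¬ :Cross #4 #5 #1 #2 :⇒ :¬ :Cross #4 #5 #2 #3 :⇒ :¬ :Cross #4 #5 #0 #3 :⇒
   (:Cross #4 #5 #1 #3 :⇒ #4 :≡ #0 :∧ #5 :≡ #2) :∧ (:Cross #4 #5 #0 #2 :⇒ #4 :≡ #1 :∧ #5 :≡ #3))
  _ (lookup (q₀ ∷ q₁ ∷ q₂ ∷ q₃ ∷ c ∷ d ∷ []))

FlipAt-IsColTri : ∀ {m} v {k w} → IsColTri m v → FlipAt m v k w → IsColTri m w
FlipAt-IsColTri {m} v {k} V (a , b , x , y , vk≡ab , a<x , x<b , ax , xb , inj₁ (y<a , ya , yb , refl)) =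
  IsColTri-update v k V
    (crossing-IsDiag (<-trans y<a a<x , <-trans x<b (proj₂ ab-seg)) ab-seg yx⋈ab)
    (subst (Cross (y , x)) (sym vk≡ab) yx⋈ab)
    λ l vl⋈yx → trans (uncurry (cong₂ _,_)
      (proj₂ (quadrilateral-chord y<a a<x x<b (¬⋈ l ya) (¬⋈ l ax) (¬⋈ l xb) (¬⋈ l yb)) vl⋈yx)) (sym vk≡ab)
  where
  ¬⋈ : ∀ l {t} → InTri m v t → ¬ Cross (lookup v l) t
  ¬⋈ = diagonal-InTri-noncrossing v V

  ab-seg : IsSeg m (a , b)
  ab-seg = InTri⇒IsSeg v V (inj₂ (k , vk≡ab))

  yx⋈ab : Cross (y , x) (a , b)
  yx⋈ab = inj₁ (y<a , a<x , x<b)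
FlipAt-IsColTri {m} v {k} V (a , b , x , y , vk≡ab , a<x , x<b , ax , xb , inj₂ (b<y , y<m+3 , ay , by , refl)) =
  IsColTri-update v k V
    (crossing-IsDiag (<-trans x<b b<y , y<m+3) ab-seg xy⋈ab)
    (subst (Cross (x , y)) (sym vk≡ab) xy⋈ab)
    λ l vl⋈xy → trans (uncurry (cong₂ _,_)
      (proj₁ (quadrilateral-chord a<x x<b b<y (¬⋈ l ax) (¬⋈ l xb) (¬⋈ l by) (¬⋈ l ay)) vl⋈xy)) (sym vk≡ab)
  where
  ¬⋈ : ∀ l {t} → InTri m v t → ¬ Cross (lookup v l) t
  ¬⋈ = diagonal-InTri-noncrossing v V

  ab-seg : IsSeg m (a , b)
  ab-seg = InTri⇒IsSeg v V (inj₂ (k , vk≡ab))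

  xy⋈ab : Cross (x , y) (a , b)
  xy⋈ab = inj₂ (a<x , x<b , b<y)

Reachable-trans : ∀ {n u v w} → Reachable n u v → Reachable n v w → Reachable n u w
Reachable-trans here r = r
Reachable-trans (there a r) r′ = there a (Reachable-trans r r′)

Reachable-sym : ∀ {n u v} → Reachable n u v → Reachable n v u
Reachable-sym here = here
Reachable-sym (there (inj₁ f) r) = Reachable-trans (Reachable-sym r) (there (inj₂ f) here)
Reachable-sym (there (inj₂ f) r) = Reachable-trans (Reachable-sym r) (there (inj₁ f) here)

FlipAt⇒Reachable : ∀ {n} v {k w} → IsColTri n v → FlipAt n v k w → Reachable n v w
FlipAt⇒Reachable _ V f = there (inj₁ (V , _ , f)) here

-- Pairwise non-crossing diagonals

IsNoncrossingFamily : ∀ {L} → (Fin L → Seg) → Set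
IsNoncrossingFamily u = (∀ i j → i ≢ j → u i ≢ u j) × (∀ i j → ¬ Cross (u i) (u j))

IsNoncrossingFamily-∷ : ∀ {L s} {u : Fin L → Seg} → IsNoncrossingFamily u →
  (∀ i → u i ≢ s) → (∀ i → ¬ Cross s (u i)) → IsNoncrossingFamily (s ∷ᶠ u)
IsNoncrossingFamily-∷ {s = s} {u} (distinct , noncrossing) ≢s ¬s⋈ = distinct′ , noncrossing′
  where
  distinct′ : ∀ i j → i ≢ j → (s ∷ᶠ u) i ≢ (s ∷ᶠ u) j
  distinct′ Fin.zero Fin.zero 0≢0 = contradiction refl 0≢0
  distinct′ Fin.zero (Fin.suc j) _ = ≢s j ∘ sym
  distinct′ (Fin.suc i) Fin.zero _ = ≢s i
  distinct′ (Fin.suc i) (Fin.suc j) i+1≢j+1 = distinct i j (i+1≢j+1 ∘ cong Fin.suc)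

  noncrossing′ : ∀ i j → ¬ Cross ((s ∷ᶠ u) i) ((s ∷ᶠ u) j)
  noncrossing′ Fin.zero Fin.zero = Cross-irrefl s
  noncrossing′ Fin.zero (Fin.suc j) = ¬s⋈ j
  noncrossing′ (Fin.suc i) Fin.zero = ¬s⋈ i ∘ Cross-sym (u i) s
  noncrossing′ (Fin.suc i) (Fin.suc j) = noncrossing i j

overlapping-nested : ∀ {a b c d p} → a < p → p < b → c < p → p < d → ¬ Cross (a , b) (c , d) →
                     (a ≤ c × d ≤ b) ⊎ (c ≤ a × b ≤ d)
overlapping-nested {a} {b} {c} {d} {p} = valid
  (#0 :< #4 :⇒ #4 :< #1 :⇒ #2 :< #4 :⇒ #4 :< #3 :⇒ :¬ :Cross #0 #1 #2 #3 :⇒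
   (#0 :≤ #2 :∧ #3 :≤ #1) :∨ (#2 :≤ #0 :∧ #1 :≤ #3))
  _ (lookup (a ∷ b ∷ c ∷ d ∷ p ∷ []))

module NoncrossingFamily {L : ℕ} (w : Fin L → Seg)
  (wide : ∀ i → suc (proj₁ (w i)) < proj₂ (w i)) (W : IsNoncrossingFamily w) where

  private
    distinct : ∀ i j → i ≢ j → w i ≢ w j
    distinct = proj₁ W

    noncrossing : ∀ i j → ¬ Cross (w i) (w j)
    noncrossing = proj₂ W

    left right : Fin L → ℕ
    left i = proj₁ (w i)
    right i = proj₂ (w i)

  _⊏_ : Fin L → Fin L → Set
  j ⊏ i = left i ≤ left j × right j ≤ right i × j ≢ i

  Inside : Fin L → ℕ → Set
  Inside i p = left i < p × p < right i

  Free : Fin L → ℕ → Set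
  Free i p = Inside i p × ∀ j → j ⊏ i → ¬ Inside j p

  Free-injective : ∀ {i j p} → Free i p → Free j p → i ≡ j
  Free-injective {i} {j} (p∈i , i-free) (p∈j , j-free) with i Fin.≟ j
  ... | yes i≡j = i≡j
  ... | no i≢j = nested (overlapping-nested (proj₁ p∈i) (proj₂ p∈i) (proj₁ p∈j) (proj₂ p∈j) (noncrossing i j))
    where
    nested : (left i ≤ left j × right j ≤ right i) ⊎ (left j ≤ left i × right i ≤ right j) → i ≡ j
    nested (inj₁ (li≤lj , rj≤ri)) = contradiction p∈j (i-free j (li≤lj , rj≤ri , i≢j ∘ sym))
    nested (inj₂ (lj≤li , ri≤rj)) = contradiction p∈i (j-free i (lj≤li , ri≤rj , i≢j))

  private
    covered? : ∀ i q → Dec (∃ λ j → j ⊏ i × Inside j q)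
    covered? i q = any? λ j →
      (left i ≤? left j ×-dec right j ≤? right i ×-dec ¬? (j Fin.≟ i)) ×-dec (left j <? q ×-dec q <? right j)

    Pinned : Fin L → ℕ → Set
    Pinned i q = ∀ j → j ⊏ i → Inside j q → left j ≡ left i

  -- From left i + 1, jump to the right end of a covering member until no member covers the point.
  -- Covering members start at left i (Pinned), so, being different from i, they end before right i.
  free-point : ∀ i → ∃ (Free i)
  free-point i = walk (right i) (suc (left i)) (m≤m+n _ _) ≤-refl (wide i)
    λ j (li≤lj , _) (lj<li+1 , _) → ≤-antisym (s≤s⁻¹ lj<li+1) li≤lj
    where
    walk : ∀ r q → right i ≤ r + q → left i < q → q < right i → Pinned i q → ∃ (Free i)
    walk zero q ri≤q _ q<ri _ = contradiction ri≤q (<⇒≱ q<ri)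
    walk (suc r) q ri≤r+q li<q q<ri pinned with covered? i q
    ... | no uncovered = q , (li<q , q<ri) , λ j j⊏i q∈j → uncovered (j , j⊏i , q∈j)
    ... | yes (j , j⊏i@(_ , rj≤ri , j≢i) , q∈j@(lj<q , q<rj)) =
      walk r (right j) (≤-trans ri≤r+q (subst (_≤ r + right j) (+-suc r q) (+-monoʳ-≤ r q<rj)))
        (<-trans li<q q<rj) rj<ri pinned′
      where
      lj≡li : left j ≡ left i
      lj≡li = pinned j j⊏i q∈j

      rj<ri : right j < right i
      rj<ri = ≤∧≢⇒< rj≤ri λ rj≡ri → distinct j i j≢i (cong₂ _,_ lj≡li rj≡ri)

      pinned′ : Pinned i (right j)
      pinned′ k (li≤lk , _) (lk<rj , rj<rk) = ≤-antisym
        (≮⇒≥ λ li<lk → noncrossing k j (inj₂ (subst (_< left k) (sym lj≡li) li<lk , lk<rj , rj<rk)))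
        li≤lk

outer-IsEdge : ∀ m → IsEdge m (0 , m + 2)
outer-IsEdge m = (<-≤-trans z<s (m≤n+m 2 m) , +-monoʳ-< m ≤-refl) , inj₂ (refl , refl)

-- Adjoining the outer edge (0 , m + 2), every member of the family gets its own free point in 1 … m + 1.
noncrossing-diagonals-bound : ∀ {m L} (u : Fin L → Seg) → (∀ i → IsDiag m (u i)) → IsNoncrossingFamily u → L ≤ m
noncrossing-diagonals-bound {m} {L} u diag U = s≤s⁻¹ (injective⇒≤ index-injective)
  where
  outer : Seg
  outer = (0 , m + 2)

  outer≢ : ∀ i → u i ≢ outer
  outer≢ i ui≡outer = proj₂ (proj₂ (diag i)) (,-injectiveˡ ui≡outer , ,-injectiveʳ ui≡outer)

  outer-noncrossing : ∀ i → ¬ Cross outer (u i)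
  outer-noncrossing i = Edge-noncrossing (proj₁ (diag i)) (outer-IsEdge m) ∘ Cross-sym outer (u i)

  w : Fin (suc L) → Seg
  w = outer ∷ᶠ u

  wide : ∀ i → suc (proj₁ (w i)) < proj₂ (w i)
  wide Fin.zero = <-≤-trans (s<s z<s) (m≤n+m 2 m)
  wide (Fin.suc i) = proj₁ (proj₂ (diag i))

  open NoncrossingFamily w wide (IsNoncrossingFamily-∷ U outer≢ outer-noncrossing)

  point : Fin (suc L) → ℕ
  point i = proj₁ (free-point i)

  point>0 : ∀ i → point i > 0
  point>0 i = ≤-<-trans z≤n (proj₁ (proj₁ (proj₂ (free-point i))))

  point<m+2 : ∀ i → point i < m + 2
  point<m+2 Fin.zero = proj₂ (proj₁ (proj₂ (free-point Fin.zero)))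
  point<m+2 (Fin.suc i) =
    <-≤-trans (proj₂ (proj₁ (proj₂ (free-point (Fin.suc i))))) (m<n+3⇒m≤n+2 (proj₂ (proj₁ (diag i))))

  index : Fin (suc L) → Fin (suc m)
  index i = fromℕ< (s≤s (pred-mono-≤ (s≤s⁻¹ (subst (point i <_) (+-comm m 2) (point<m+2 i)))))

  index-injective : ∀ {i j} → index i ≡ index j → i ≡ j
  index-injective {i} {j} eq =
    Free-injective (proj₂ (free-point i)) (subst (Free j) (sym point-eq) (proj₂ (free-point j)))
    where
    point-eq : point i ≡ point j
    point-eq = pred-injective ⦃ >-nonZero (point>0 i) ⦄ ⦃ >-nonZero (point>0 j) ⦄ (fromℕ<-injective _ _ _ _ eq)

_≟ₛ_ : DecidableEquality Seg
_≟ₛ_ = ≡-dec _≟_ _≟_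

Cross? : ∀ s t → Dec (Cross s t)
Cross? (a , b) (c , d) = (a <? c ×-dec c <? b ×-dec b <? d) ⊎-dec (c <? a ×-dec a <? d ×-dec d <? b)

IsColTri-maximal : ∀ {m} v {s} → IsColTri m v → IsDiag m s →
                   (∃ λ k → lookup v k ≡ s) ⊎ (∃ λ l → Cross s (lookup v l))
IsColTri-maximal {m} v {s} (diag , V) s-diag
  with any? (λ k → lookup v k ≟ₛ s) | any? (λ l → Cross? s (lookup v l))
... | yes present | _ = inj₁ present
... | no _ | yes crossing = inj₂ crossing
... | no absent | no uncrossed = contradiction
  (noncrossing-diagonals-bound (s ∷ᶠ lookup v) diag′
    (IsNoncrossingFamily-∷ V (λ k vk≡s → absent (k , vk≡s)) λ l s⋈vl → uncrossed (l , s⋈vl)))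
  (<⇒≱ ≤-refl)
  where
  diag′ : ∀ i → IsDiag m ((s ∷ᶠ lookup v) i)
  diag′ Fin.zero = s-diag
  diag′ (Fin.suc i) = diag i

IsSeg-edge-or-diag : ∀ {m s} → IsSeg m s → IsEdge m s ⊎ IsDiag m s
IsSeg-edge-or-diag {m} {a , b} seg with b ≟ suc a | (a ≟ 0) ×-dec (b ≟ m + 2)
... | yes b≡a+1 | _ = inj₁ (seg , inj₁ b≡a+1)
... | no _ | yes outer = inj₁ (seg , inj₂ outer)
... | no b≢a+1 | no ¬outer = inj₂ (seg , ≤∧≢⇒< (proj₁ seg) (b≢a+1 ∘ sym) , ¬outer)

uncrossed-InTri : ∀ {m} v {s} → IsColTri m v → IsSeg m s → (∀ l → ¬ Cross s (lookup v l)) → InTri m v s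
uncrossed-InTri v V seg uncrossed with IsSeg-edge-or-diag seg
... | inj₁ edge = inj₁ edge
... | inj₂ diag with IsColTri-maximal v V diag
...   | inj₁ present = inj₂ present
...   | inj₂ (l , crossing) = contradiction crossing (uncrossed l)

-- Making the ear a diagonal

least : ∀ {P : ℕ → Set} → Decidable P → ∀ {b} → P b → ∃ λ x → P x × ∀ {y} → y < x → ¬ P y
least {P} P? {b} Pb = search b 0 refl λ y<0 → contradiction y<0 n≮0
  where
  search : ∀ r k → k + r ≡ b → (∀ {y} → y < k → ¬ P y) → ∃ λ x → P x × ∀ {y} → y < x → ¬ P y
  search zero k k+0≡b below = k , subst P (trans (sym k+0≡b) (+-identityʳ k)) Pb , below
  search (suc r) k k+r+1≡b below with P? k
  ... | yes Pk = k , Pk , below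
  ... | no ¬Pk = search r (suc k) (trans (sym (+-suc k r)) k+r+1≡b) λ y<k+1 → case m<1+n⇒m<n∨m≡n y<k+1 of λ
    { (inj₁ y<k) → below y<k
    ; (inj₂ refl) → ¬Pk }

ear : ℕ → Seg
ear n = (0 , n + 2)

ear-IsDiag : ∀ n → IsDiag (suc n) (ear n)
ear-IsDiag n = (<-≤-trans z<s (m≤n+m 2 n) , m<n⇒m<1+n (+-monoʳ-< n ≤-refl)) , <-≤-trans (s<s z<s) (m≤n+m 2 n) ,
  λ (_ , n+2≡n+3) → <-irrefl n+2≡n+3 ≤-refl

-- Vertex T = n + 3 is the last vertex of the (n + 4)-gon; ear n cuts off the triangle {0, n + 2, T}.
module Ear (n : ℕ) where

  T : ℕ
  T = suc (n + 2)

  T<n+4 : T < suc n + 3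
  T<n+4 = s<s (+-monoʳ-< n ≤-refl)

  ≤T : ∀ {f} → f < suc n + 3 → f ≤ T
  ≤T = m<n+3⇒m≤n+2 {n = suc n}

  DiagonalsAtT≥ : ℕ → ColTri (suc n) → Set
  DiagonalsAtT≥ t v = ∀ l {e} → lookup v l ≡ (e , T) → t ≤ e

  ReachesEar : ColTri (suc n) → Set
  ReachesEar v = ∃ λ w → Reachable (suc n) v w × IsColTri (suc n) w × ∃ λ k → lookup w k ≡ ear n

  ReachesEar-trans : ∀ {v v′} → Reachable (suc n) v v′ → ReachesEar v′ → ReachesEar v
  ReachesEar-trans v→v′ (w , v′→w , rest) = w , Reachable-trans v→v′ v′→w , rest

  ear-present : ∀ v → IsColTri (suc n) v → DiagonalsAtT≥ (n + 2) v → ∃ λ k → lookup v k ≡ ear n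
  ear-present v V@(diag , _ , _) atT with IsColTri-maximal v V (ear-IsDiag n)
  ... | inj₁ present = present
  ... | inj₂ (l , inj₁ (_ , c<n+2 , n+2<d)) =
    contradiction (atT l (cong (proj₁ (lookup v l) ,_) (≤-antisym (≤T (proj₂ (proj₁ (diag l)))) n+2<d)))
                  (<⇒≱ c<n+2)

  skip : ∀ {t v} → DiagonalsAtT≥ t v → (∀ l → lookup v l ≢ (t , T)) → DiagonalsAtT≥ (suc t) v
  skip atT absent l {e} vl≡eT = ≤∧≢⇒< (atT l vl≡eT) λ { refl → absent l vl≡eT }

  -- Flipping the diagonal (c , T) with least c: its triangles are {0, c, T} and {c, x, T}
  -- for the next neighbour x of T, and it becomes (0 , x).
  module FlipFirst (v : ColTri (suc n)) (V : IsColTri (suc n) v) {c l} (vl≡cT : lookup v l ≡ (c , T))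
                   (atT : DiagonalsAtT≥ c v) where

    private
      diag : ∀ l′ → IsDiag (suc n) (lookup v l′)
      diag = proj₁ V

      distinct : ∀ l′ l″ → l′ ≢ l″ → lookup v l′ ≢ lookup v l″
      distinct = proj₁ (proj₂ V)

      noncrossing : ∀ l′ l″ → ¬ Cross (lookup v l′) (lookup v l″)
      noncrossing = proj₂ (proj₂ V)

    cT-diag : IsDiag (suc n) (c , T)
    cT-diag = subst (IsDiag (suc n)) vl≡cT (diag l)

    ¬crosses-cT : ∀ l′ → ¬ Cross (lookup v l′) (c , T)
    ¬crosses-cT l′ = subst (λ s → ¬ Cross (lookup v l′) s) vl≡cT (noncrossing l′ l)

    0<c : 0 < c
    0<c = n≢0⇒n>0 λ c≡0 → proj₂ (proj₂ cT-diag) (c≡0 , refl)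

    0c-InTri : InTri (suc n) v (0 , c)
    0c-InTri = uncrossed-InTri v V (0<c , <-trans (proj₁ (proj₁ cT-diag)) T<n+4) uncrossed
      where
      uncrossed : ∀ l′ → ¬ Cross (0 , c) (lookup v l′)
      uncrossed l′ (inj₁ (_ , e<c , c<f)) with m≤n⇒m<n∨m≡n (≤T (proj₂ (proj₁ (diag l′))))
      ... | inj₁ f<T = ¬crosses-cT l′ (inj₁ (e<c , c<f , f<T))
      ... | inj₂ f≡T = <⇒≱ e<c (atT l′ (cong (proj₁ (lookup v l′) ,_) f≡T))

    NextNeighbour : ℕ → Set
    NextNeighbour y = c < y × (y ≡ n + 2 ⊎ ∃ λ l′ → lookup v l′ ≡ (y , T))

    next-neighbour : ∃ λ x → NextNeighbour x × ∀ {y} → y < x → ¬ NextNeighbour y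
    next-neighbour = least (λ y → c <? y ×-dec (y ≟ n + 2 ⊎-dec any? λ l′ → lookup v l′ ≟ₛ (y , T)))
                           (s≤s⁻¹ (proj₁ (proj₂ cT-diag)) , inj₁ refl)

    module Neighbour {x} (x-next : NextNeighbour x) (x-least : ∀ {y} → y < x → ¬ NextNeighbour y) where

      c<x : c < x
      c<x = proj₁ x-next

      xT-InTri : InTri (suc n) v (x , T)
      xT-InTri with proj₂ x-next
      ... | inj₁ refl = inj₁ ((≤-refl , T<n+4) , inj₁ refl)
      ... | inj₂ present = inj₂ present

      x<T : x < T
      x<T = proj₁ (InTri⇒IsSeg v V xT-InTri)

      cx-InTri : InTri (suc n) v (c , x)
      cx-InTri = uncrossed-InTri v V (c<x , <-trans x<T T<n+4) uncrossed
        where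
        uncrossed : ∀ l′ → ¬ Cross (c , x) (lookup v l′)
        uncrossed l′ (inj₂ (e<c , c<f , f<x)) = ¬crosses-cT l′ (inj₁ (e<c , c<f , <-trans f<x x<T))
        uncrossed l′ (inj₁ (c<e , e<x , x<f)) with m≤n⇒m<n∨m≡n (≤T (proj₂ (proj₁ (diag l′))))
        ... | inj₁ f<T = diagonal-InTri-noncrossing v V l′ xT-InTri (inj₁ (e<x , x<f , f<T))
        ... | inj₂ f≡T = x-least e<x (c<e , inj₂ (l′ , cong (proj₁ (lookup v l′) ,_) f≡T))

      flip : FlipAt (suc n) v l (v [ l ]≔ (0 , x))
      flip = c , T , x , 0 , vl≡cT , c<x , x<T , cx-InTri , xT-InTri ,
             inj₁ (0<c , 0c-InTri , inj₁ (outer-IsEdge (suc n)) , refl)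

      atT′ : DiagonalsAtT≥ (suc c) (v [ l ]≔ (0 , x))
      atT′ l′ {e} wl′≡eT with l′ Fin.≟ l
      ... | yes refl = contradiction (,-injectiveʳ (trans (sym (lookup∘update l v (0 , x))) wl′≡eT)) (<⇒≢ x<T)
      ... | no l′≢l = ≤∧≢⇒< (atT l′ vl′≡eT) λ { refl → distinct l′ l l′≢l (trans vl′≡eT (sym vl≡cT)) }
        where
        vl′≡eT : lookup v l′ ≡ (e , T)
        vl′≡eT = trans (sym (lookup∘update′ l′≢l v (0 , x))) wl′≡eT

  advance : ∀ {t} v → IsColTri (suc n) v → DiagonalsAtT≥ t v →
            ∃ λ w → Reachable (suc n) v w × IsColTri (suc n) w × DiagonalsAtT≥ (suc t) w
  advance {t} v V atT with any? (λ l → lookup v l ≟ₛ (t , T))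
  ... | no absent = v , here , V , skip {v = v} atT λ l vl≡tT → absent (l , vl≡tT)
  ... | yes (l , vl≡tT) = _ , FlipAt⇒Reachable v V flip , FlipAt-IsColTri v V flip , atT′
    where
    open FlipFirst v V vl≡tT atT
    open Neighbour (proj₁ (proj₂ next-neighbour)) (proj₂ (proj₂ next-neighbour))

  sweep : ∀ s {t} → s + t ≡ n + 2 → ∀ v → IsColTri (suc n) v → DiagonalsAtT≥ t v → ReachesEar v
  sweep zero refl v V atT = v , here , V , ear-present v V atT
  sweep (suc s) {t} s+1+t≡n+2 v V atT =
    let w , v→w , W , atT′ = advance v V atT
    in ReachesEar-trans v→w (sweep s (trans (+-suc s t) s+1+t≡n+2) w W atT′)

reach-ear : ∀ n v → IsColTri (suc n) v → Ear.ReachesEar n v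
reach-ear n v V = Ear.sweep n (n + 2) (+-identityʳ _) v V λ _ _ → z≤n

-- Inserting and removing the ear

data PunchInView {n} (k : Fin (suc n)) : Fin (suc n) → Set where
  at : PunchInView k k
  punched : ∀ l → PunchInView k (punchIn k l)

punchIn-view : ∀ {n} (k i : Fin (suc n)) → PunchInView k i
punchIn-view k i with k Fin.≟ i
... | yes refl = at
... | no k≢i = subst (PunchInView k) (punchIn-punchOut k≢i) (punched (punchOut k≢i))

insertAt-update : ∀ {A : Set} {n} (u : Vec A n) k l s x →
                  insertAt (u [ l ]≔ s) k x ≡ insertAt u k x [ punchIn k l ]≔ s
insertAt-update u Fin.zero l s x = refl
insertAt-update (y ∷ u) (Fin.suc k) Fin.zero s x = refl
insertAt-update (y ∷ u) (Fin.suc k) (Fin.suc l) s x = cong (y ∷_) (insertAt-update u k l s x)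

lookup-removeAt : ∀ {A : Set} {n} (v : Vec A (suc n)) k l → lookup (removeAt v k) l ≡ lookup v (punchIn k l)
lookup-removeAt v k l = trans (sym (insertAt-punchIn (removeAt v k) k (lookup v k) l))
                              (cong (λ u → lookup u (punchIn k l)) (insertAt-removeAt v k))

IsSeg-suc : ∀ {n s} → IsSeg n s → IsSeg (suc n) s
IsSeg-suc (a<b , b<n+3) = a<b , m<n⇒m<1+n b<n+3

IsDiag-suc : ∀ {n s} → IsDiag n s → IsDiag (suc n) s
IsDiag-suc (seg@(_ , b<n+3) , wide , _) =
  IsSeg-suc seg , wide , λ (_ , b≡n+3) → <⇒≢ (s≤s (m<n+3⇒m≤n+2 b<n+3)) b≡n+3

-- Such a diagonal cannot end at n + 3: a diagonal (c , n + 3) with 0 < c < n + 2 crosses the ear.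
IsDiag-pred : ∀ {n s} → IsDiag (suc n) s → s ≢ ear n → ¬ Cross s (ear n) → IsDiag n s
IsDiag-pred {n} {c , d} ((c<d , d<n+4) , wide , ¬outer) s≢ear ¬s⋈ear =
  (c<d , d<n+3) , wide , λ (c≡0 , d≡n+2) → s≢ear (cong₂ _,_ c≡0 d≡n+2)
  where
  d<n+3 : d < n + 3
  d<n+3 with m≤n⇒m<n∨m≡n (m<n+3⇒m≤n+2 {n = suc n} d<n+4)
  ... | inj₁ d<n+3 = subst (d <_) (sym (+-suc n 2)) d<n+3
  ... | inj₂ refl = contradiction (inj₂ (n≢0⇒n>0 (λ c≡0 → ¬outer (c≡0 , refl)) , s≤s⁻¹ wide , ≤-refl)) ¬s⋈ear

insertEar : ∀ {n} → ColTri n → Fin (suc n) → ColTri (suc n)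
insertEar {n} u k = insertAt u k (ear n)

insertEar-IsColTri : ∀ {n} u k → IsColTri n u → IsColTri (suc n) (insertEar u k)
insertEar-IsColTri {n} u k (diag , distinct , noncrossing) = diag′ , distinct′ , noncrossing′
  where
  at-k : lookup (insertEar u k) k ≡ ear n
  at-k = insertAt-lookup u k (ear n)

  at-punchIn : ∀ l → lookup (insertEar u k) (punchIn k l) ≡ lookup u l
  at-punchIn = insertAt-punchIn u k (ear n)

  ≢ear : ∀ l → lookup u l ≢ ear n
  ≢ear l ul≡ear = proj₂ (proj₂ (diag l)) (,-injectiveˡ ul≡ear , ,-injectiveʳ ul≡ear)

  ¬crosses-ear : ∀ l → ¬ Cross (lookup u l) (ear n)
  ¬crosses-ear l = Edge-noncrossing (proj₁ (diag l)) (outer-IsEdge n)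

  diag′ : ∀ i → IsDiag (suc n) (lookup (insertEar u k) i)
  diag′ i with punchIn-view k i
  ... | at rewrite at-k = ear-IsDiag n
  ... | punched l rewrite at-punchIn l = IsDiag-suc (diag l)

  distinct′ : ∀ i j → i ≢ j → lookup (insertEar u k) i ≢ lookup (insertEar u k) j
  distinct′ i j i≢j with punchIn-view k i | punchIn-view k j
  ... | at | at = contradiction refl i≢j
  ... | at | punched l rewrite at-k | at-punchIn l = ≢ear l ∘ sym
  ... | punched l | at rewrite at-k | at-punchIn l = ≢ear l
  ... | punched l | punched l′ rewrite at-punchIn l | at-punchIn l′ = distinct l l′ (i≢j ∘ cong (punchIn k))

  noncrossing′ : ∀ i j → ¬ Cross (lookup (insertEar u k) i) (lookup (insertEar u k) j)
  noncrossing′ i j with punchIn-view k i | punchIn-view k j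
  ... | at | at rewrite at-k = Cross-irrefl (ear n)
  ... | at | punched l rewrite at-k | at-punchIn l = ¬crosses-ear l ∘ Cross-sym (ear n) (lookup u l)
  ... | punched l | at rewrite at-k | at-punchIn l = ¬crosses-ear l
  ... | punched l | punched l′ rewrite at-punchIn l | at-punchIn l′ = noncrossing l l′

-- The outer edge of the smaller polygon becomes the inserted diagonal.
InTri-insertEar : ∀ {n} u k {s} → InTri n u s → InTri (suc n) (insertEar u k) s
InTri-insertEar u k (inj₁ (seg , inj₁ b≡a+1)) = inj₁ (IsSeg-suc seg , inj₁ b≡a+1)
InTri-insertEar {n} u k (inj₁ (_ , inj₂ (refl , refl))) = inj₂ (k , insertAt-lookup u k (ear n))
InTri-insertEar {n} u k (inj₂ (l , ul≡s)) = inj₂ (punchIn k l , trans (insertAt-punchIn u k (ear n) l) ul≡s)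

FlipAt-insertEar : ∀ {n} u k {l w} → FlipAt n u l w →
                   FlipAt (suc n) (insertEar u k) (punchIn k l) (insertEar w k)
FlipAt-insertEar {n} u k {l} (a , b , x , y , ul≡ab , a<x , x<b , ax , xb , inj₁ (y<a , ya , yb , refl)) =
  a , b , x , y , trans (insertAt-punchIn u k (ear n) l) ul≡ab , a<x , x<b ,
  InTri-insertEar u k ax , InTri-insertEar u k xb ,
  inj₁ (y<a , InTri-insertEar u k ya , InTri-insertEar u k yb , insertAt-update u k l _ _)
FlipAt-insertEar {n} u k {l} (a , b , x , y , ul≡ab , a<x , x<b , ax , xb , inj₂ (b<y , y<n+3 , ay , by , refl)) =
  a , b , x , y , trans (insertAt-punchIn u k (ear n) l) ul≡ab , a<x , x<b ,
  InTri-insertEar u k ax , InTri-insertEar u k xb ,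
  inj₂ (b<y , m<n⇒m<1+n y<n+3 , InTri-insertEar u k ay , InTri-insertEar u k by , insertAt-update u k l _ _)

Reachable-insertEar : ∀ {n u w} k → Reachable n u w → Reachable (suc n) (insertEar u k) (insertEar w k)
Reachable-insertEar k here = here
Reachable-insertEar k (there adj r) = there (Adj-insertEar adj) (Reachable-insertEar k r)
  where
  Flip-insertEar : ∀ {u w} → Flip _ u w → Flip _ (insertEar u k) (insertEar w k)
  Flip-insertEar {u} (U , l , f) = insertEar-IsColTri u k U , punchIn k l , FlipAt-insertEar u k f

  Adj-insertEar : ∀ {u w} → Adj _ u w → Adj _ (insertEar u k) (insertEar w k)
  Adj-insertEar (inj₁ f) = inj₁ (Flip-insertEar f)
  Adj-insertEar (inj₂ f) = inj₂ (Flip-insertEar f)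

removeEar-IsColTri : ∀ {n} v k → IsColTri (suc n) v → lookup v k ≡ ear n → IsColTri n (removeAt v k)
removeEar-IsColTri {n} v k (diag , distinct , noncrossing) vk≡ear = diag′ , distinct′ , noncrossing′
  where
  diag′ : ∀ l → IsDiag n (lookup (removeAt v k) l)
  diag′ l rewrite lookup-removeAt v k l = IsDiag-pred (diag (punchIn k l))
    (λ vl≡ear → distinct _ _ (punchInᵢ≢i k l) (trans vl≡ear (sym vk≡ear)))
    (subst (λ s → ¬ Cross (lookup v (punchIn k l)) s) vk≡ear (noncrossing (punchIn k l) k))

  distinct′ : ∀ i j → i ≢ j → lookup (removeAt v k) i ≢ lookup (removeAt v k) j
  distinct′ i j i≢j rewrite lookup-removeAt v k i | lookup-removeAt v k j =
    distinct _ _ (i≢j ∘ punchIn-injective k i j)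

  noncrossing′ : ∀ i j → ¬ Cross (lookup (removeAt v k) i) (lookup (removeAt v k) j)
  noncrossing′ i j rewrite lookup-removeAt v k i | lookup-removeAt v k j = noncrossing _ _

insertEar-removeAt : ∀ {n} v k → lookup v k ≡ ear n → insertEar (removeAt v k) k ≡ v
insertEar-removeAt v k vk≡ear = trans (cong (insertAt (removeAt v k) k) (sym vk≡ear)) (insertAt-removeAt v k)

-- Exchanging two colours in a pentagon

flip-up : ∀ {m v k q₀ q₁ q₂ q₃} → lookup v k ≡ (q₀ , q₂) → q₀ < q₁ → q₁ < q₂ → q₂ < q₃ → q₃ < m + 3 →
  InTri m v (q₀ , q₁) → InTri m v (q₁ , q₂) → InTri m v (q₂ , q₃) → InTri m v (q₀ , q₃) →
  FlipAt m v k (v [ k ]≔ (q₁ , q₃))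
flip-up vk≡02 q₀<q₁ q₁<q₂ q₂<q₃ q₃<m+3 s₀₁ s₁₂ s₂₃ s₀₃ =
  _ , _ , _ , _ , vk≡02 , q₀<q₁ , q₁<q₂ , s₀₁ , s₁₂ , inj₂ (q₂<q₃ , q₃<m+3 , s₀₃ , s₂₃ , refl)

flip-down : ∀ {m v k q₀ q₁ q₂ q₃} → lookup v k ≡ (q₁ , q₃) → q₀ < q₁ → q₁ < q₂ → q₂ < q₃ →
  InTri m v (q₀ , q₁) → InTri m v (q₁ , q₂) → InTri m v (q₂ , q₃) → InTri m v (q₀ , q₃) →
  FlipAt m v k (v [ k ]≔ (q₀ , q₂))
flip-down vk≡13 q₀<q₁ q₁<q₂ q₂<q₃ s₀₁ s₁₂ s₂₃ s₀₃ =
  _ , _ , _ , _ , vk≡13 , q₁<q₂ , q₂<q₃ , s₁₂ , s₂₃ , inj₁ (q₀<q₁ , s₀₁ , s₀₃ , refl)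

module Pentagon {m} {α β : Fin m} (α≢β : α ≢ β) where

  data InTriAway (v : ColTri m) (s : Seg) : Set where
    edge : IsEdge m s → InTriAway v s
    diagonal : ∀ l → l ≢ α → l ≢ β → lookup v l ≡ s → InTriAway v s

  InTriAway-update : ∀ {v s k t} → k ≡ α ⊎ k ≡ β → InTriAway v s → InTriAway (v [ k ]≔ t) s
  InTriAway-update _ (edge e) = edge e
  InTriAway-update {v} {t = t} k∈αβ (diagonal l l≢α l≢β vl≡s) =
    diagonal l l≢α l≢β (trans (lookup∘update′ (l≢k k∈αβ) v t) vl≡s)
    where
    l≢k : ∀ {k} → k ≡ α ⊎ k ≡ β → l ≢ k
    l≢k (inj₁ refl) = l≢α
    l≢k (inj₂ refl) = l≢β

  InTriAway⇒InTri : ∀ {v s} → InTriAway v s → InTri m v s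
  InTriAway⇒InTri (edge e) = inj₁ e
  InTriAway⇒InTri (diagonal l _ _ vl≡s) = inj₂ (l , vl≡s)

  InTri⇒InTriAway : ∀ {v s} → InTri m v s → s ≢ lookup v α → s ≢ lookup v β → InTriAway v s
  InTri⇒InTriAway (inj₁ e) _ _ = edge e
  InTri⇒InTriAway (inj₂ (l , vl≡s)) s≢vα s≢vβ =
    diagonal l (λ { refl → s≢vα (sym vl≡s) }) (λ { refl → s≢vβ (sym vl≡s) }) vl≡s

  -- The five triangulations of the pentagon p₀ … p₄ form a cycle of flips; going once around it
  -- brings the diagonals back to (p₀ , p₂) and (p₀ , p₃) with their colours exchanged.
  swap : ∀ v {p₀ p₁ p₂ p₃ p₄} → IsColTri m v → lookup v α ≡ (p₀ , p₂) → lookup v β ≡ (p₀ , p₃) →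
    p₀ < p₁ → p₁ < p₂ → p₂ < p₃ → p₃ < p₄ → p₄ < m + 3 →
    InTri m v (p₀ , p₁) → InTri m v (p₁ , p₂) → InTri m v (p₂ , p₃) → InTri m v (p₃ , p₄) → InTri m v (p₀ , p₄) →
    ∃ λ w → Reachable m v w × IsColTri m w × lookup w α ≡ (p₀ , p₃) × lookup w β ≡ (p₀ , p₂)
  swap v {p₀} {p₁} {p₂} {p₃} {p₄} V vα≡02 vβ≡03 p₀<p₁ p₁<p₂ p₂<p₃ p₃<p₄ p₄<m+3 s₀₁ s₁₂ s₂₃ s₃₄ s₀₄ =
    S₅ ,
    Reachable-trans (FlipAt⇒Reachable v V f₁) (Reachable-trans (FlipAt⇒Reachable S₁ V₁ f₂)
      (Reachable-trans (FlipAt⇒Reachable S₂ V₂ f₃) (Reachable-trans (FlipAt⇒Reachable S₃ V₃ f₄)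
        (FlipAt⇒Reachable S₄ V₄ f₅)))) ,
    FlipAt-IsColTri S₄ V₄ f₅ , atα S₄ _ , trans (β-after-α S₄ _) (atβ S₃ _)
    where
    S₁ S₂ S₃ S₄ S₅ : ColTri m
    S₁ = v [ α ]≔ (p₁ , p₃)
    S₂ = S₁ [ β ]≔ (p₁ , p₄)
    S₃ = S₂ [ α ]≔ (p₂ , p₄)
    S₄ = S₃ [ β ]≔ (p₀ , p₂)
    S₅ = S₄ [ α ]≔ (p₀ , p₃)

    atα : ∀ u s → lookup (u [ α ]≔ s) α ≡ s
    atα u s = lookup∘update α u s

    atβ : ∀ u s → lookup (u [ β ]≔ s) β ≡ s
    atβ u s = lookup∘update β u s

    β-after-α : ∀ u s → lookup (u [ α ]≔ s) β ≡ lookup u β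
    β-after-α u s = lookup∘update′ (α≢β ∘ sym) u s

    α-after-β : ∀ u s → lookup (u [ β ]≔ s) α ≡ lookup u α
    α-after-β u s = lookup∘update′ α≢β u s

    keep₁ : ∀ {s} → InTriAway v s → InTriAway S₁ s
    keep₁ = InTriAway-update (inj₁ refl)

    keep₂ : ∀ {s} → InTriAway v s → InTriAway S₂ s
    keep₂ = InTriAway-update (inj₂ refl) ∘ keep₁

    keep₃ : ∀ {s} → InTriAway v s → InTriAway S₃ s
    keep₃ = InTriAway-update (inj₁ refl) ∘ keep₂

    keep₄ : ∀ {s} → InTriAway v s → InTriAway S₄ s
    keep₄ = InTriAway-update (inj₂ refl) ∘ keep₃

    Kept : Seg → Set
    Kept s = ∀ {u} → (InTriAway v s → InTriAway u s) → InTri m u s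

    side : ∀ {s} → InTri m v s → s ≢ (p₀ , p₂) → s ≢ (p₀ , p₃) → Kept s
    side s∈v s≢02 s≢03 keep = InTriAway⇒InTri (keep
      (InTri⇒InTriAway s∈v (subst (_ ≢_) (sym vα≡02) s≢02) (subst (_ ≢_) (sym vβ≡03) s≢03)))

    fst≢ : ∀ {a b c d} → a ≢ c → (a , b) ≢ (c , d)
    fst≢ a≢c = a≢c ∘ ,-injectiveˡ

    snd≢ : ∀ {a b c d} → b ≢ d → (a , b) ≢ (c , d)
    snd≢ b≢d = b≢d ∘ ,-injectiveʳ

    p₀<p₂ : p₀ < p₂
    p₀<p₂ = <-trans p₀<p₁ p₁<p₂
    p₀<p₃ : p₀ < p₃
    p₀<p₃ = <-trans p₀<p₂ p₂<p₃
    p₁<p₃ : p₁ < p₃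
    p₁<p₃ = <-trans p₁<p₂ p₂<p₃
    p₂<p₄ : p₂ < p₄
    p₂<p₄ = <-trans p₂<p₃ p₃<p₄
    p₃<m+3 : p₃ < m + 3
    p₃<m+3 = <-trans p₃<p₄ p₄<m+3

    s₀₁′ : Kept (p₀ , p₁)
    s₀₁′ = side s₀₁ (snd≢ (<⇒≢ p₁<p₂)) (snd≢ (<⇒≢ p₁<p₃))
    s₁₂′ : Kept (p₁ , p₂)
    s₁₂′ = side s₁₂ (fst≢ (>⇒≢ p₀<p₁)) (fst≢ (>⇒≢ p₀<p₁))
    s₂₃′ : Kept (p₂ , p₃)
    s₂₃′ = side s₂₃ (fst≢ (>⇒≢ p₀<p₂)) (fst≢ (>⇒≢ p₀<p₂))
    s₃₄′ : Kept (p₃ , p₄)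
    s₃₄′ = side s₃₄ (fst≢ (>⇒≢ p₀<p₃)) (fst≢ (>⇒≢ p₀<p₃))
    s₀₄′ : Kept (p₀ , p₄)
    s₀₄′ = side s₀₄ (snd≢ (>⇒≢ p₂<p₄)) (snd≢ (>⇒≢ p₃<p₄))

    f₁ : FlipAt m v α S₁
    f₁ = flip-up vα≡02 p₀<p₁ p₁<p₂ p₂<p₃ p₃<m+3 (s₀₁′ id) (s₁₂′ id) (s₂₃′ id) (inj₂ (β , vβ≡03))

    V₁ : IsColTri m S₁
    V₁ = FlipAt-IsColTri v V f₁

    f₂ : FlipAt m S₁ β S₂
    f₂ = flip-up (trans (β-after-α v _) vβ≡03) p₀<p₁ p₁<p₃ p₃<p₄ p₄<m+3
           (s₀₁′ keep₁) (inj₂ (α , atα v _)) (s₃₄′ keep₁) (s₀₄′ keep₁)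

    V₂ : IsColTri m S₂
    V₂ = FlipAt-IsColTri S₁ V₁ f₂

    f₃ : FlipAt m S₂ α S₃
    f₃ = flip-up (trans (α-after-β S₁ _) (atα v _)) p₁<p₂ p₂<p₃ p₃<p₄ p₄<m+3
           (s₁₂′ keep₂) (s₂₃′ keep₂) (s₃₄′ keep₂) (inj₂ (β , atβ S₁ _))

    V₃ : IsColTri m S₃
    V₃ = FlipAt-IsColTri S₂ V₂ f₃

    f₄ : FlipAt m S₃ β S₄
    f₄ = flip-down (trans (β-after-α S₂ _) (atβ S₁ _)) p₀<p₁ p₁<p₂ p₂<p₄
           (s₀₁′ keep₃) (s₁₂′ keep₃) (inj₂ (α , atα S₂ _)) (s₀₄′ keep₃)

    V₄ : IsColTri m S₄
    V₄ = FlipAt-IsColTri S₃ V₃ f₄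

    f₅ : FlipAt m S₄ α S₅
    f₅ = flip-down (trans (α-after-β S₃ _) (atα S₂ _)) p₀<p₂ p₂<p₃ p₃<p₄
           (inj₂ (β , atβ S₃ _)) (s₂₃′ keep₄) (s₃₄′ keep₄) (s₀₄′ keep₄)

fan : ∀ n → ColTri n
fan zero = []
fan (suc n) = ear n ∷ fan n

fan-IsColTri : ∀ n → IsColTri n (fan n)
fan-IsColTri zero = (λ ()) , (λ ()) , (λ ())
fan-IsColTri (suc n) = insertEar-IsColTri (fan n) Fin.zero (fan-IsColTri n)

consecutive-IsEdge : ∀ m {a} → suc a < m + 3 → IsEdge m (a , suc a)
consecutive-IsEdge _ a+1<m+3 = (≤-refl , a+1<m+3) , inj₁ refl

fan-InTri : ∀ n → InTri (suc n) (fan (suc n)) (0 , suc n)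
fan-InTri zero = inj₁ (consecutive-IsEdge 1 (s<s z<s))
fan-InTri (suc n) = inj₂ (Fin.suc Fin.zero , cong (0 ,_) (+-comm n 2))

reach-fan-from-ear : ∀ {n} → (∀ u → IsColTri n u → Reachable n u (fan n)) →
  ∀ v k → IsColTri (suc n) v → lookup v k ≡ ear n → Reachable (suc n) v (insertEar (fan n) k)
reach-fan-from-ear reach v k V vk≡ear = subst (λ u → Reachable _ u _) (insertEar-removeAt v k vk≡ear)
  (Reachable-insertEar k (reach (removeAt v k) (removeEar-IsColTri v k V vk≡ear)))

-- swap exchanges the colour k of the ear with colour 0, carried by the neighbouring fan diagonal.
fan-recolour : ∀ {n} → (∀ u → IsColTri n u → Reachable n u (fan n)) →
               ∀ k → Reachable (suc n) (insertEar (fan n) k) (fan (suc n))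
fan-recolour reach Fin.zero = here
fan-recolour {zero} reach (Fin.suc ())
fan-recolour {suc n} reach (Fin.suc k) =
  let w , X→w , W , w₀≡ear , _ = swap X (insertEar-IsColTri (fan (suc n)) (Fin.suc k) (fan-IsColTri (suc n)))
        refl (insertAt-lookup (fan (suc n)) (Fin.suc k) _) z<s n+1<n+2 ≤-refl ≤-refl p₄<n+5
        (InTri-insertEar (fan (suc n)) (Fin.suc k) (fan-InTri n))
        (inj₁ ((n+1<n+2 , <-trans ≤-refl (<-trans ≤-refl p₄<n+5)) , inj₁ (+-comm n 2)))
        (inj₁ (consecutive-IsEdge (suc (suc n)) (<-trans ≤-refl p₄<n+5)))
        (inj₁ (consecutive-IsEdge (suc (suc n)) p₄<n+5))
        (inj₁ (outer-IsEdge (suc (suc n))))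
  in Reachable-trans X→w (reach-fan-from-ear reach w Fin.zero W w₀≡ear)
  where
  open Pentagon {α = Fin.zero} {β = Fin.suc k} (λ ())

  X : ColTri (suc (suc n))
  X = insertEar (fan (suc n)) (Fin.suc k)

  n+1<n+2 : suc n < n + 2
  n+1<n+2 = subst (suc n <_) (+-comm 2 n) ≤-refl

  p₄<n+5 : suc (suc (n + 2)) < suc (suc n) + 3
  p₄<n+5 = s<s (s<s (+-monoʳ-< n ≤-refl))

reach-fan : ∀ n v → IsColTri n v → Reachable n v (fan n)
reach-fan zero [] _ = here
reach-fan (suc n) v V with reach-ear n v V
... | w , v→w , W , k , wk≡ear = Reachable-trans v→w
  (Reachable-trans (reach-fan-from-ear (reach-fan n) w k W wk≡ear) (fan-recolour (reach-fan n) k))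

lemma3 : (n : ℕ) → Connected n
lemma3 n v w V W = Reachable-trans (reach-fan n v V) (Reachable-sym (reach-fan n w W))
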